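{- Let $\mathcal{L}$ be an abstract intuitionistic logic and let $\mathcal{L}'\in StIL$ be such that $\mathcal{L}$ is preserved under $\mathcal{L}'$-asimulations. Let $\Theta$ be a signature and $(\mathcal{M},w)\in Str_\mathcal{L}(\Theta)$. Then for every $\phi\in L(\Theta)$ and every $v\in[W,w]$: (1) $\mathcal{M},w\models_\mathcal{L}\phi$ iff $[\mathcal{M},w],w\models_\mathcal{L}\phi$; (2) if $\mathcal{M},w\models_\mathcal{L}\phi$ then $\mathcal{M},v\models_\mathcal{L}\phi$.
   Context: A signature $\Theta$ consists of predicate letters of positive arities and individual constants; no function symbols. A (Kripke) $\Theta$-model is $\mathcal{M}=\langle W,\prec,\mathfrak{A},\mathbb{H}\rangle$: $W\neq\emptyset$; $\prec$ a partial order; $\mathfrak{A}_w=(A_w,I_w)$ a classical $\Theta$-structure for each $w$, with pairwise disjoint domains; homomorphisms $\mathbb{H}_{wv}:\mathfrak{A}_w\to\mathfrak{A}_v$ for $w\prec v$ with $\mathbb{H}_{ww}=id$ and $\mathbb{H}_{wu}=\mathbb{H}_{vu}\circ\mathbb{H}_{wv}$. $[W,w]=\{v:w\prec v\}$ and $[\mathcal{M},w]$ is the restriction of $\mathcal{M}$ to $[W,w]$; for fresh constants $\bar c_n$ and $\bar a_n\in A_w^n$, $([\mathcal{M},w],\bar c_n/\bar a_n)$ expands it with $c_i$ denoting $\mathbb{H}_{wv}(a_i)$ at $v$. $StIL=\{\mathsf{IL},\mathsf{CD},\mathsf{IL}^\equiv,\mathsf{CD}^\equiv,\mathsf{In}^\equiv,\mathsf{Bi}^\equiv\}$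 are the standard intuitionistic first-order logics with Kripke semantics, in the language without equality ($\mathsf{IL},\mathsf{CD}$) or with equality $\equiv$ (true iff values coincide), over respectively: all models; models with all $\mathbb{H}_{wv}$ surjective; all models; surjective; injective; bijective. Asimulations. Fix pairwise distinct constants $c_1,c_2,\dots\notin\Theta$. An $\mathcal{L}'$-asimulation from $(\mathcal{M}_1,w_1,\bar a_n)$ to $(\mathcal{M}_2,w_2,\bar b_n)$ is a relation $A$ between pairs $(w;\bar\alpha_l)$ ($w\in W_i$, $\bar\alpha_l$ an $l$-tuple of elements of $\mathcal{M}_i$) and $(v;\bar\beta_l)$ ($v\in W_j$), $\{i,j\}=\{1,2\}$, with $(w_1;\bar a_n)A(w_2;\bar b_n)$, such that whenever $(w;\bar\alpha_l)A(v;\bar\beta_l)$ with $\bar\alpha_l\in(A_i)_w^l,\bar\beta_l\in(A_j)_v^l$: atomic sentences of the language of $\mathcal{L}'$ over $\Theta\cup\{c_1..c_l\}$ true at $w$ in $([\mathcal{M}_i,w],\bar c_l/\bar\alpha_l)$ are true at $v$ in $([\mathcal{M}_j,v],\bar c_l/\bar\beta_l)$; if $v\prec_j t$ some $u\succ_i w$ has $(u;\mathbb{H}_{wu}\langle\bar\alpha\rangle)A(t;\mathbb{H}_{vt}\langle\bar\beta\rangle)$ and $(t;\mathbb{H}_{vt}\langle\bar\beta\rangle)A(u;\mathbb{H}_{wu}\langle\bar\alpha\rangle)$; each $\alpha'\in(A_i)_w$ has some $\beta'\in(A_j)_v$ with $(w;\bar\alpha{}^\frown\alpha')A(v;\bar\beta{}^\frown\beta')$;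 each $t\succ_j v$ and $\beta'\in(A_j)_t$ have $u\succ_i w$, $\alpha'\in(A_i)_u$ with $(u;\mathbb{H}_{wu}\langle\bar\alpha\rangle^\frown\alpha')A(t;\mathbb{H}_{vt}\langle\bar\beta\rangle^\frown\beta')$. Abstract intuitionistic logics. A quadruple $\mathcal{L}=(Str_\mathcal{L},L,\models_\mathcal{L},\boxplus_\mathcal{L})$ where $Str_\mathcal{L}(\Theta)$ is a class of pointed $\Theta$-models closed under isomorphisms, signature renamings, changing the point within the same model, reducts, unions of countable submodel-chains with common point, and constant extensions; $L(\Theta)$ is a set of sentences; $\models_\mathcal{L}$ a satisfaction relation between $Str_\mathcal{L}(\Theta)$ and $L(\Theta)$; $\boxplus_\mathcal{L}$ selects admissible constant expansions; subject to Occurrence, Renaming, Isomorphism invariance, Expansion (truth unaffected by reducts), closure under $\bot,\to,\wedge,\vee$ and under quantifiers $\exists c,\forall c$ with intuitionistic semantics. $\mathcal{L}$ is preserved under $\mathcal{L}'$-asimulations iff for all $(\mathcal{M}_1,w_1),(\mathcal{M}_2,w_2)\in Str_\mathcal{L}(\Theta)$, if there is an $\mathcal{L}'$-asimulation from $(\mathcal{M}_1,w_1)$ to $(\mathcal{M}_2,w_2)$ (empty tuples), then every $\phi\in L(\Theta)$ true at $(\mathcal{M}_1,w_1)$ is true at $(\mathcal{M}_2,w_2)$. -}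

module Defs where

open import Data.Nat using (ℕ; suc; NonZero)
open import Data.Fin using (Fin)
open import Data.Bool using (Bool; true; false; T)
open import Data.Vec using (Vec; []; map; lookup; _∷ʳ_)
open import Data.Product using (Σ; _×_; _,_; proj₁; proj₂)
open import Data.Empty using (⊥)
open import Data.Sum using (_⊎_)
open import Relation.Binary.PropositionalEquality using (_≡_; refl; cong)

record Signature : Set₁ where
  field
    Pred      : Set
    arity     : Pred → ℕ
    arity-pos : ∀ P → NonZero (arity P)
    Const     : Set
open Signature public

-- Kripke Θ-models.  Domains of different worlds are distinct types
-- (hence pairwise disjoint); ≺ is a (proof-irrelevant) partial order.

record Model (Θ : Signature) : Set₁ where
  field
    W         : Set
    _≺_       : W → W → Set
    ≺-prop    : ∀ {w v} (p q : w ≺ v) → p ≡ q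
    ≺-refl    : ∀ w → w ≺ w
    ≺-trans   : ∀ {w v u} → w ≺ v → v ≺ u → w ≺ u
    ≺-antisym : ∀ {w v} → w ≺ v → v ≺ w → w ≡ v
    Dom       : W → Set
    Rel       : ∀ w (P : Pred Θ) → Vec (Dom w) (arity Θ P) → Set
    con       : ∀ w → Const Θ → Dom w
    H         : ∀ {w v} → w ≺ v → Dom w → Dom v
    H-rel     : ∀ {w v} (p : w ≺ v) P as → Rel w P as → Rel v P (map (H p) as)
    H-con     : ∀ {w v} (p : w ≺ v) c → H p (con w c) ≡ con v c
    H-id      : ∀ w x → H (≺-refl w) x ≡ x
    H-comp    : ∀ {w v u} (p : w ≺ v) (q : v ≺ u) x →
                H (≺-trans p q) x ≡ H q (H p x)
open Model public

module _ {Θ : Signature} (M : Model Θ) (w : W M) where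
  private
    _≤_ = _≺_ M
    Cone = Σ (W M) (λ v → w ≤ v)
    cone-≡ : ∀ {v u} {p : w ≤ v} {q : w ≤ u} → v ≡ u →
             _≡_ {A = Cone} (v , p) (u , q)
    cone-≡ {p = p} {q} refl = cong (λ r → (_ , r)) (≺-prop M p q)

  restrict : Model Θ
  restrict = record
    { W         = Cone
    ; _≺_       = λ a b → proj₁ a ≤ proj₁ b
    ; ≺-prop    = ≺-prop M
    ; ≺-refl    = λ a → ≺-refl M (proj₁ a)
    ; ≺-trans   = ≺-trans M
    ; ≺-antisym = λ p q → cone-≡ (≺-antisym M p q)
    ; Dom       = λ a → Dom M (proj₁ a)
    ; Rel       = λ a → Rel M (proj₁ a)
    ; con       = λ a → con M (proj₁ a)
    ; H         = H M
    ; H-rel     = H-rel M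
    ; H-con     = H-con M
    ; H-id      = λ a → H-id M (proj₁ a)
    ; H-comp    = H-comp M
    }

  conePoint : W restrict
  conePoint = (w , ≺-refl M w)

record Pointed (Θ : Signature) : Set₁ where
  constructor ⟨_,_⟩
  field
    model : Model Θ
    point : W model
open Pointed public

-- Atomic sentences over Θ ∪ {c₁ … c_l}; equations only when eq = true

data Term (Θ : Signature) (l : ℕ) : Set where
  cst : Const Θ → Term Θ l
  var : Fin l → Term Θ l          -- the fresh constant c_(i+1)

data Atom (Θ : Signature) (eq : Bool) (l : ℕ) : Set where
  pred : (P : Pred Θ) → Vec (Term Θ l) (arity Θ P) → Atom Θ eq l
  equ  : T eq → Term Θ l → Term Θ l → Atom Θ eq l

⟦_⟧ : ∀ {Θ l} → Term Θ l → (M : Model Θ) (w : W M) → Vec (Dom M w) l → Dom M w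
⟦ cst c ⟧ M w α = con M w c
⟦ var i ⟧ M w α = lookup α i

holds : ∀ {Θ eq l} → (M : Model Θ) (w : W M) → Vec (Dom M w) l → Atom Θ eq l → Set
holds M w α (pred P ts) = Rel M w P (map (λ t → ⟦ t ⟧ M w α) ts)
holds M w α (equ _ s t) = ⟦ s ⟧ M w α ≡ ⟦ t ⟧ M w α

data StIL : Set where
  IL CD ILeq CDeq Ineq Bieq : StIL

hasEq : StIL → Bool
hasEq IL   = false
hasEq CD   = false
hasEq ILeq = true
hasEq CDeq = true
hasEq Ineq = true
hasEq Bieq = true

Cfg : ∀ {Θ} → Model Θ → ℕ → Set
Cfg M l = Σ (W M) (λ w → Vec (Dom M w) l)

Relation : ∀ {Θ} → Model Θ → Model Θ → Set₁
Relation M N = ∀ l → Cfg M l → Cfg N l → Set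

record AsimConds {Θ} (eq : Bool) (M N : Model Θ)
                 (R : Relation M N) (S : Relation N M) : Set where
  field
    atoms : ∀ {l w v} {α : Vec (Dom M w) l} {β : Vec (Dom N v) l} →
            R l (w , α) (v , β) →
            (a : Atom Θ eq l) → holds M w α a → holds N v β a
    back  : ∀ {l w v} {α : Vec (Dom M w) l} {β : Vec (Dom N v) l} →
            R l (w , α) (v , β) →
            ∀ t (p : _≺_ N v t) → Σ (W M) λ u → Σ (_≺_ M w u) λ q →
              R l (u , map (H M q) α) (t , map (H N p) β) ×
              S l (t , map (H N p) β) (u , map (H M q) α)
    forth-elem : ∀ {l w v} {α : Vec (Dom M w) l} {β : Vec (Dom N v) l} →
            R l (w , α) (v , β) →
            ∀ (a : Dom M w) → Σ (Dom N v) λ b →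
              R (suc l) (w , α ∷ʳ a) (v , β ∷ʳ b)
    back-elem : ∀ {l w v} {α : Vec (Dom M w) l} {β : Vec (Dom N v) l} →
            R l (w , α) (v , β) →
            ∀ t (p : _≺_ N v t) (b : Dom N t) →
              Σ (W M) λ u → Σ (_≺_ M w u) λ q → Σ (Dom M u) λ a →
                R (suc l) (u , map (H M q) α ∷ʳ a) (t , map (H N p) β ∷ʳ b)

-- an L'-asimulation (eq = hasEq L') from (M₁, w₁, ā) to (M₂, w₂, b̄):
-- a relation with a part R from M₁ to M₂ and a part S from M₂ to M₁
record Asimulation {Θ} (eq : Bool) {n : ℕ}
                   (M₁ : Model Θ) (w₁ : W M₁) (a : Vec (Dom M₁ w₁) n)
                   (M₂ : Model Θ) (w₂ : W M₂) (b : Vec (Dom M₂ w₂) n) : Set₁ where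
  field
    R     : Relation M₁ M₂
    S     : Relation M₂ M₁
    condR : AsimConds eq M₁ M₂ R S
    condS : AsimConds eq M₂ M₁ S R
    start : R n (w₁ , a) (w₂ , b)

_↔_ : Set → Set → Set
A ↔ B = (A → B) × (B → A)

record AbstractIntLogic : Set₂ where
  field
    Str : (Θ : Signature) → Pointed Θ → Set
    L   : Signature → Set
    _⊨_ : ∀ {Θ} → Pointed Θ → L Θ → Set
    Str-point : ∀ {Θ} (M : Model Θ) (w v : W M) →
                Str Θ ⟨ M , w ⟩ → Str Θ ⟨ M , v ⟩
    falsum : ∀ Θ → Σ (L Θ) λ χ → ∀ P → Str Θ P → (P ⊨ χ) ↔ ⊥
    conj   : ∀ Θ (φ ψ : L Θ) → Σ (L Θ) λ χ → ∀ P → Str Θ P →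
             (P ⊨ χ) ↔ ((P ⊨ φ) × (P ⊨ ψ))
    disj   : ∀ Θ (φ ψ : L Θ) → Σ (L Θ) λ χ → ∀ P → Str Θ P →
             (P ⊨ χ) ↔ ((P ⊨ φ) ⊎ (P ⊨ ψ))
    impl   : ∀ Θ (φ ψ : L Θ) → Σ (L Θ) λ χ → ∀ M w → Str Θ ⟨ M , w ⟩ →
             (⟨ M , w ⟩ ⊨ χ) ↔
             (∀ v → _≺_ M w v → ⟨ M , v ⟩ ⊨ φ → ⟨ M , v ⟩ ⊨ ψ)
open AbstractIntLogic public

PreservedUnder : AbstractIntLogic → StIL → Set₁
PreservedUnder 𝓛 L' = ∀ {Θ} (M₁ M₂ : Model Θ) (w₁ : W M₁) (w₂ : W M₂) →
  Str 𝓛 Θ ⟨ M₁ , w₁ ⟩ → Str 𝓛 Θ ⟨ M₂ , w₂ ⟩ →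
  Asimulation (hasEq L') M₁ w₁ [] M₂ w₂ [] →
  ∀ (φ : L 𝓛 Θ) → _⊨_ 𝓛 ⟨ M₁ , w₁ ⟩ φ → _⊨_ 𝓛 ⟨ M₂ , w₂ ⟩ φ

{-# OPTIONS --safe #-}
-- Both claims are instances of preservation under asimulations.  For (1),
-- relating each configuration of M over the cone [W , w] to the same
-- configuration of [M , w] is an asimulation in both directions.  For (2),
-- relating (u ; ᾱ) to (t ; H_ut ᾱ) whenever u ≺ t is an asimulation from
-- (M , w) to (M , v): atomic facts persist along the homomorphisms, and
-- functoriality of H lets every later move be answered by the same world.
module Submission where

open import Defs
open import Data.Product using (_×_; Σ; _,_; proj₁; proj₂)
open import Data.Vec using (Vec; []; map; _∷ʳ_)
open import Data.Vec.Properties using (map-cong; map-∘; map-id; lookup-map; map-∷ʳ)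
open import Relation.Binary.PropositionalEquality

module _ {Θ : Signature} (M : Model Θ) where

  map-H-refl : ∀ {l} w (α : Vec (Dom M w) l) → map (H M (≺-refl M w)) α ≡ α
  map-H-refl w α = trans (map-cong (H-id M w) α) (map-id α)

  map-H-trans : ∀ {l u v t} (p : _≺_ M u v) (q : _≺_ M v t) (α : Vec (Dom M u) l) →
                map (H M (≺-trans M p q)) α ≡ map (H M q) (map (H M p) α)
  map-H-trans p q α = trans (map-cong (H-comp M p q) α) (map-∘ (H M q) (H M p) α)

  ⟦⟧-H : ∀ {l u t} (p : _≺_ M u t) (α : Vec (Dom M u) l) (s : Term Θ l) →
         ⟦ s ⟧ M t (map (H M p) α) ≡ H M p (⟦ s ⟧ M u α)
  ⟦⟧-H p α (cst c) = sym (H-con M p c)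
  ⟦⟧-H p α (var i) = lookup-map i (H M p) α

  holds-H : ∀ {eq l u t} (p : _≺_ M u t) (α : Vec (Dom M u) l) (a : Atom Θ eq l) →
            holds M u α a → holds M t (map (H M p) α) a
  holds-H {u = u} {t} p α (pred P ts) h = subst (Rel M t P) ⟦ts⟧-H (H-rel M p P _ h)
    where
    ⟦ts⟧-H : map (H M p) (map (λ s → ⟦ s ⟧ M u α) ts)
           ≡ map (λ s → ⟦ s ⟧ M t (map (H M p) α)) ts
    ⟦ts⟧-H = trans (sym (map-∘ (H M p) _ ts)) (map-cong (λ s → sym (⟦⟧-H p α s)) ts)
  holds-H p α (equ _ s s') h = begin
    ⟦ s ⟧ M _ (map (H M p) α)   ≡⟨ ⟦⟧-H p α s ⟩
    H M p (⟦ s ⟧ M _ α)         ≡⟨ cong (H M p) h ⟩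
    H M p (⟦ s' ⟧ M _ α)        ≡⟨ ⟦⟧-H p α s' ⟨
    ⟦ s' ⟧ M _ (map (H M p) α)  ∎
    where open ≡-Reasoning

  Transported : Relation M M
  Transported l (u , α) (t , β) = Σ (_≺_ M u t) λ p → β ≡ map (H M p) α

  transported-≡ : ∀ {l t} {α β : Vec (Dom M t) l} → β ≡ α → Transported l (t , α) (t , β)
  transported-≡ {t = t} {α} β≡α = ≺-refl M t , trans β≡α (sym (map-H-refl t α))

  transported-asimConds : ∀ eq → AsimConds eq M M Transported Transported
  transported-asimConds eq = record
    { atoms      = λ { {α = α} (p , refl) → holds-H p α }
    ; back       = λ { {α = α} (p , refl) t q →
        t , ≺-trans M p q ,
        transported-≡ (sym (map-H-trans p q α)) , transported-≡ (map-H-trans p q α) }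
    ; forth-elem = λ { {α = α} (p , refl) a →
        H M p a , p , sym (map-∷ʳ (H M p) a α) }
    ; back-elem  = λ { {α = α} (p , refl) t q b →
        t , ≺-trans M p q , b , transported-≡ (cong (_∷ʳ b) (sym (map-H-trans p q α))) }
    }

  ≺-asimulation : ∀ {eq w v} → _≺_ M w v → Asimulation eq M w [] M v []
  ≺-asimulation w≺v = record
    { R = Transported ; S = Transported
    ; condR = transported-asimConds _ ; condS = transported-asimConds _
    ; start = w≺v , refl }

module _ {Θ : Signature} (M : Model Θ) (w : W M) where

  private
    Cone = restrict M w

  ⟦⟧-restrict : ∀ {l} (c : W Cone) (β : Vec (Dom M (proj₁ c)) l) (s : Term Θ l) →
                ⟦ s ⟧ Cone c β ≡ ⟦ s ⟧ M (proj₁ c) β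
  ⟦⟧-restrict c β (cst x) = refl
  ⟦⟧-restrict c β (var i) = refl

  holds-restrict : ∀ {eq l} (c : W Cone) (β : Vec (Dom M (proj₁ c)) l) (a : Atom Θ eq l) →
                   holds Cone c β a ≡ holds M (proj₁ c) β a
  holds-restrict c β (pred P ts) = cong (Rel M (proj₁ c) P) (map-cong (⟦⟧-restrict c β) ts)
  holds-restrict c β (equ _ s s') = cong₂ _≡_ (⟦⟧-restrict c β s) (⟦⟧-restrict c β s')

  Into-cone : Relation M Cone
  Into-cone l (u , α) (c , β) = _≡_ {A = Cfg M l} (u , α) (proj₁ c , β)

  Out-of-cone : Relation Cone M
  Out-of-cone l (c , β) (u , α) = _≡_ {A = Cfg M l} (proj₁ c , β) (u , α)

  into-cone-asimConds : ∀ eq → AsimConds eq M Cone Into-cone Out-of-cone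
  into-cone-asimConds eq = record
    { atoms      = λ { {v = c} {β = β} refl a → subst (λ X → X) (sym (holds-restrict c β a)) }
    ; back       = λ { refl t p → proj₁ t , p , refl , refl }
    ; forth-elem = λ { refl a → a , refl }
    ; back-elem  = λ { refl t p b → proj₁ t , p , b , refl }
    }

  out-of-cone-asimConds : ∀ eq → AsimConds eq Cone M Out-of-cone Into-cone
  out-of-cone-asimConds eq = record
    { atoms      = λ { {w = c} {α = β} refl a → subst (λ X → X) (holds-restrict c β a) }
    ; back       = λ { {w = c} refl t p → (t , ≺-trans M (proj₂ c) p) , p , refl , refl }
    ; forth-elem = λ { refl a → a , refl }
    ; back-elem  = λ { {w = c} refl t p b → (t , ≺-trans M (proj₂ c) p) , p , b , refl }
    }

  cone-asimulation : ∀ {eq} → Asimulation eq M w [] Cone (conePoint M w) []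
  cone-asimulation = record
    { R = Into-cone ; S = Out-of-cone
    ; condR = into-cone-asimConds _ ; condS = out-of-cone-asimConds _
    ; start = refl }

reverse : ∀ {Θ eq n} {M₁ M₂ : Model Θ} {w₁ w₂} {a : Vec (Dom M₁ w₁) n} {b : Vec (Dom M₂ w₂) n}
          (A : Asimulation eq M₁ w₁ a M₂ w₂ b) → Asimulation.S A n (w₂ , b) (w₁ , a) →
          Asimulation eq M₂ w₂ b M₁ w₁ a
reverse A S-start = record
  { R = S ; S = R ; condR = condS ; condS = condR ; start = S-start }
  where open Asimulation A hiding (start)

module _ (𝓛 : AbstractIntLogic) {L' : StIL} (preserved : PreservedUnder 𝓛 L') where

  ⊨-invariant : ∀ {Θ} {M₁ M₂ : Model Θ} {w₁ w₂} →
                Str 𝓛 Θ ⟨ M₁ , w₁ ⟩ → Str 𝓛 Θ ⟨ M₂ , w₂ ⟩ →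
                (A : Asimulation (hasEq L') M₁ w₁ [] M₂ w₂ []) →
                Asimulation.S A 0 (w₂ , []) (w₁ , []) →
                ∀ φ → _⊨_ 𝓛 ⟨ M₁ , w₁ ⟩ φ ↔ _⊨_ 𝓛 ⟨ M₂ , w₂ ⟩ φ
  ⊨-invariant str₁ str₂ A S-start φ =
    preserved _ _ _ _ str₁ str₂ A φ , preserved _ _ _ _ str₂ str₁ (reverse A S-start) φ

lemma4p4 : (𝓛 : AbstractIntLogic) (L' : StIL) → PreservedUnder 𝓛 L' →
    (Θ : Signature) (M : Model Θ) (w : W M) → Str 𝓛 Θ ⟨ M , w ⟩ →
    (φ : L 𝓛 Θ) (v : W M) → _≺_ M w v →
      (Str 𝓛 Θ ⟨ restrict M w , conePoint M w ⟩ →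
         (_⊨_ 𝓛 ⟨ M , w ⟩ φ ↔ _⊨_ 𝓛 ⟨ restrict M w , conePoint M w ⟩ φ))
      × (_⊨_ 𝓛 ⟨ M , w ⟩ φ → _⊨_ 𝓛 ⟨ M , v ⟩ φ)
lemma4p4 𝓛 L' preserved Θ M w str-w φ v w≺v =
  (λ str-cone → ⊨-invariant 𝓛 preserved str-w str-cone (cone-asimulation M w) refl φ)
  , preserved M M w v str-w (Str-point 𝓛 M w v str-w) (≺-asimulation M w≺v) φ
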